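{- Let $k\ge 2$ be an integer and set $\mathcal{P}_k=\{p \text{ prime}: (p-1)\mid (k-1)\}$ and $M_k=\prod_{p\in\mathcal{P}_k}p$. If integers $a,b,c,d$ satisfy $a^k+b^k=c^k+d^k$ and $h=(c+d)-(a+b)$, then $M_k\mid h$. -}

module Defs where

open import Data.Nat using (ℕ; suc; _∸_)
open import Data.Nat.Divisibility using (_∣_; _∣?_)
open import Data.Nat.Primality using (Prime; prime?)
open import Data.List using (List; filter; upTo)
open import Data.Nat.ListAction using (product)
open import Data.Product using (_×_)
open import Relation.Nullary.Decidable using (_×-dec_)

InP : ℕ → ℕ → Set
InP k p = Prime p × ((p ∸ 1) ∣ (k ∸ 1))

-- 𝒫_k as an explicit list.  For k ≥ 2 every such p satisfies p ≤ k
-- (p - 1 divides the positive number k - 1), so scanning 0..k is complete.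
𝒫 : ℕ → List ℕ
𝒫 k = filter (λ p → prime? p ×-dec ((p ∸ 1) ∣? (k ∸ 1))) (upTo (suc k))

M : ℕ → ℕ
M k = product (𝒫 k)

{-# OPTIONS --safe #-}
-- For p ∈ 𝒫_k write k = 1 + t(p − 1).  Fermat's little theorem x^p ≡ x (mod p), which
-- follows from p ∣ C(p, i) for 0 < i < p and the binomial theorem, iterates to
-- x^k ≡ x (mod p) for every integer x.  Hence h ≡ (c^k + d^k) − (a^k + b^k) = 0 (mod p)
-- for each p ∈ 𝒫_k, and since these primes are distinct their product M_k divides h.
module Submission where

open import Defs

module PrimeDivisibility where

  open import Data.Nat.Base
  open import Data.Nat.Properties using (*-zeroʳ; *-identityʳ; +-identityʳ; *-distribˡ-+)
  open import Data.Nat.Divisibility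
  open import Data.Nat.Primality using (Prime; euclidsLemma)
  open import Data.Nat.Primality.Factorisation using (factorisationHasAllPrimeFactors)
  open import Data.Nat.Coprimality using (prime⇒coprime; coprime-divisor)
  open import Data.Nat.Combinatorics using (_C_; nC1≡n; nCk+nC[k+1]≡[n+1]C[k+1])
  open import Data.Nat.ListAction using (product)
  open import Data.Nat.Tactic.RingSolver using (solve-∀)
  open import Data.List.Relation.Unary.All using (All; []; _∷_)
  open import Data.List.Relation.Unary.All.Properties using (All¬⇒¬Any)
  open import Data.List.Relation.Unary.AllPairs using ([]; _∷_)
  open import Data.List.Relation.Unary.Unique.Propositional using (Unique)
  open import Data.Sum using (inj₁; inj₂)
  open import Relation.Nullary using (¬_; contradiction)
  open import Relation.Binary.PropositionalEquality
  open ≡-Reasoning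

  [k+1]*[n+1]C[k+1]≡[n+1]*nCk : ∀ n k → suc k * (suc n C suc k) ≡ suc n * (n C k)
  [k+1]*[n+1]C[k+1]≡[n+1]*nCk zero    zero    = refl
  [k+1]*[n+1]C[k+1]≡[n+1]*nCk zero    (suc k) = *-zeroʳ (2 + k)
  [k+1]*[n+1]C[k+1]≡[n+1]*nCk (suc n) zero    = begin
    suc (suc n) C 1 + 0  ≡⟨ +-identityʳ _ ⟩
    suc (suc n) C 1      ≡⟨ nC1≡n (2 + n) ⟩
    2 + n                ≡⟨ *-identityʳ (2 + n) ⟨
    (2 + n) * 1          ∎
  [k+1]*[n+1]C[k+1]≡[n+1]*nCk (suc n) (suc k) = begin
    (2 + k) * (suc (suc n) C suc (suc k))
      ≡⟨ cong ((2 + k) *_) (nCk+nC[k+1]≡[n+1]C[k+1] (suc n) (suc k)) ⟨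
    (2 + k) * (A + B)
      ≡⟨ regroup k A B ⟩
    A + ((1 + k) * A + (2 + k) * B)
      ≡⟨ cong₂ (λ u v → A + (u + v)) ([k+1]*[n+1]C[k+1]≡[n+1]*nCk n k)
                                     ([k+1]*[n+1]C[k+1]≡[n+1]*nCk n (suc k)) ⟩
    A + ((1 + n) * (n C k) + (1 + n) * (n C suc k))
      ≡⟨ cong (A +_) (*-distribˡ-+ (1 + n) (n C k) (n C suc k)) ⟨
    A + (1 + n) * (n C k + n C suc k)
      ≡⟨ cong (λ s → A + (1 + n) * s) (nCk+nC[k+1]≡[n+1]C[k+1] n k) ⟩
    (2 + n) * A ∎
    where
    A = suc n C suc k
    B = suc n C suc (suc k)
    regroup : ∀ k A B → (2 + k) * (A + B) ≡ A + ((1 + k) * A + (2 + k) * B)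
    regroup = solve-∀

  p∣pC[k+1] : ∀ {p k} → Prime p → suc k < p → p ∣ p C suc k
  p∣pC[k+1] {suc p} {k} p-prime k<p = coprime-divisor (prime⇒coprime p-prime k<p)
    (subst (suc p ∣_) (sym ([k+1]*[n+1]C[k+1]≡[n+1]*nCk p k)) (m∣m*n (p C k)))

  p*m∣n : ∀ {p m n} → Prime p → ¬ p ∣ m → p ∣ n → m ∣ n → p * m ∣ n
  p*m∣n {m = m} p-prime p∤m p∣n (divides t refl) with euclidsLemma t m p-prime p∣n
  ... | inj₁ p∣t = *-monoˡ-∣ m p∣t
  ... | inj₂ p∣m = contradiction p∣m p∤m

  distinctPrimes⇒product∣ : ∀ {ps n} → Unique ps → All Prime ps → All (_∣ n) ps →
                            product ps ∣ n
  distinctPrimes⇒product∣ [] [] [] = 1∣ _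
  distinctPrimes⇒product∣ (p∉ps ∷ unique) (p-prime ∷ primes) (p∣n ∷ ps∣n) =
    p*m∣n p-prime p∤product p∣n (distinctPrimes⇒product∣ unique primes ps∣n)
    where
    p∤product = λ p∣product →
      All¬⇒¬Any p∉ps (factorisationHasAllPrimeFactors p-prime p∣product primes)

open PrimeDivisibility

module PowerCongruences where

  open import Data.Nat.Base as ℕ using (ℕ; zero; suc; _∸_)
  open import Data.Nat.Properties using (+-suc; n∸n≡0)
  import Data.Nat.Divisibility as ℕ
  open import Data.Nat.Primality using (Prime; ¬prime[0])
  open import Data.Nat.Combinatorics using (_C_; nCn≡1)
  open import Data.Fin.Base using (Fin; zero; suc; fromℕ; inject₁)
  open import Data.Fin.Properties using (toℕ-fromℕ; inject₁ℕ<)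
  open import Data.Integer.Base
    using (ℤ; +_; -[1+_]; 0ℤ; -1ℤ; 1ℤ; _+_; _-_; _*_; _^_; +-*-rawSemiring)
    renaming (suc to sucℤ)
  open import Data.Integer.Properties
    using (+-0-monoid; +-*-commutativeSemiring; +-identityˡ; +-identityʳ;
           *-identityˡ; *-identityʳ; suc-*; ^-identityʳ; ^-zeroˡ; ^-distribˡ-+-*; i≡j⇒i-j≡0)
  open import Data.Integer.Divisibility.Signed
  open import Data.Integer.Tactic.RingSolver using (solve-∀)
  -- The library's binomial theorem is stated with the generic semiring power and natural
  -- multiple, here _^ᵐ_ and _·_; ^ᵐ≡^ and ·≡* translate them back to ℤ.
  open import Algebra.Definitions.RawSemiring +-*-rawSemiring
    using (sum) renaming (_×_ to _·_; _^_ to _^ᵐ_)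
  open import Algebra.Properties.Monoid.Sum +-0-monoid using (sum-init-last)
  import Algebra.Properties.CommutativeSemiring.Binomial +-*-commutativeSemiring as Binomial
  open Binomial using (binomial; binomialTerm)
  open import Function.Base using (_∘_)
  open import Relation.Nullary using (contradiction)
  open import Relation.Binary.PropositionalEquality
  open ≡-Reasoning

  ·≡* : ∀ n i → n · i ≡ + n * i
  ·≡* zero    i = refl
  ·≡* (suc n) i = trans (cong (_+_ i) (·≡* n i)) (sym (suc-* (+ n) i))

  ∣n⇒∣n·i : ∀ {p n} i → p ℕ.∣ n → + p ∣ n · i
  ∣n⇒∣n·i {p} {n} i p∣n =
    subst (+ p ∣_) (sym (·≡* n i)) (∣m⇒∣m*n i (∣ᵤ⇒∣ {i = + n} p∣n))

  ^ᵐ≡^ : ∀ i n → i ^ᵐ n ≡ i ^ n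
  ^ᵐ≡^ i zero    = refl
  ^ᵐ≡^ i (suc n) = cong (i *_) (^ᵐ≡^ i n)

  ∣-sum : ∀ {k n} {f : Fin n → ℤ} → (∀ i → k ∣ f i) → k ∣ sum f
  ∣-sum {n = zero}  _   = divides 0ℤ refl
  ∣-sum {n = suc n} k∣f = ∣m∣n⇒∣m+n (k∣f zero) (∣-sum (k∣f ∘ suc))

  ℤ-induction : ∀ {ℓ} (P : ℤ → Set ℓ) → P 0ℤ →
                (∀ i → P i → P (sucℤ i)) → (∀ i → P (sucℤ i) → P i) → ∀ i → P i
  ℤ-induction P P0 up down (+ zero)      = P0
  ℤ-induction P P0 up down (+ suc n)     = up (+ n) (ℤ-induction P P0 up down (+ n))
  ℤ-induction P P0 up down -[1+ zero ]   = down -1ℤ P0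
  ℤ-induction P P0 up down -[1+ suc n ]  =
    down -[1+ suc n ] (ℤ-induction P P0 up down -[1+ n ])

  module _ (x : ℤ) (n : ℕ) where

    binomialTerm[0]≡x^n : binomialTerm 1ℤ x n zero ≡ x ^ n
    binomialTerm[0]≡x^n = begin
      1ℤ * x ^ᵐ n + 0ℤ  ≡⟨ +-identityʳ _ ⟩
      1ℤ * x ^ᵐ n       ≡⟨ *-identityˡ _ ⟩
      x ^ᵐ n            ≡⟨ ^ᵐ≡^ x n ⟩
      x ^ n             ∎

    binomialTerm[n]≡1 : binomialTerm 1ℤ x n (fromℕ n) ≡ 1ℤ
    binomialTerm[n]≡1 = begin
      binomialTerm 1ℤ x n (fromℕ n)
        ≡⟨ cong (λ k → (n C k) · (1ℤ ^ᵐ k * x ^ᵐ (n ∸ k))) (toℕ-fromℕ n) ⟩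
      (n C n) · (1ℤ ^ᵐ n * x ^ᵐ (n ∸ n))
        ≡⟨ cong₂ (λ c e → c · (1ℤ ^ᵐ n * x ^ᵐ e)) (nCn≡1 n) (n∸n≡0 n) ⟩
      1ℤ ^ᵐ n * 1ℤ + 0ℤ  ≡⟨ +-identityʳ _ ⟩
      1ℤ ^ᵐ n * 1ℤ       ≡⟨ *-identityʳ _ ⟩
      1ℤ ^ᵐ n            ≡⟨ ^ᵐ≡^ 1ℤ n ⟩
      1ℤ ^ n             ≡⟨ ^-zeroˡ n ⟩
      1ℤ                 ∎

  p∣[1+x]^p-x^p-1 : ∀ {p} → Prime p → ∀ x → + p ∣ (1ℤ + x) ^ p - x ^ p - 1ℤ
  p∣[1+x]^p-x^p-1 {zero}  p-prime x = contradiction p-prime ¬prime[0]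
  p∣[1+x]^p-x^p-1 {suc q} p-prime x = subst (+ p ∣_) middle≡ (∣-sum p∣middle)
    where
    p = suc q
    term : Fin (suc p) → ℤ
    term = binomialTerm 1ℤ x p
    middle : Fin q → ℤ
    middle i = term (suc (inject₁ i))
    p∣middle : ∀ i → + p ∣ middle i
    p∣middle i = ∣n⇒∣n·i (binomial 1ℤ x p (suc (inject₁ i)))
                         (p∣pC[k+1] p-prime (ℕ.s<s (inject₁ℕ< i)))
    expansion : (1ℤ + x) ^ p ≡ x ^ p + (sum middle + 1ℤ)
    expansion = begin
      (1ℤ + x) ^ p
        ≡⟨ ^ᵐ≡^ (1ℤ + x) p ⟨
      (1ℤ + x) ^ᵐ p
        ≡⟨ Binomial.theorem p 1ℤ x ⟩
      term zero + sum (term ∘ suc)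
        ≡⟨ cong₂ _+_ (binomialTerm[0]≡x^n x p) (sum-init-last (term ∘ suc)) ⟩
      x ^ p + (sum middle + term (fromℕ p))
        ≡⟨ cong (λ t → x ^ p + (sum middle + t)) (binomialTerm[n]≡1 x p) ⟩
      x ^ p + (sum middle + 1ℤ) ∎
    cancel : ∀ Y S → Y + (S + 1ℤ) - Y - 1ℤ ≡ S
    cancel = solve-∀
    middle≡ : sum middle ≡ (1ℤ + x) ^ p - x ^ p - 1ℤ
    middle≡ =
      sym (trans (cong (λ t → t - x ^ p - 1ℤ) expansion) (cancel (x ^ p) (sum middle)))

  p∣x^p-x : ∀ {p} → Prime p → ∀ x → + p ∣ x ^ p - x
  p∣x^p-x {zero}  p-prime = contradiction p-prime ¬prime[0]
  p∣x^p-x {suc q} p-prime = ℤ-induction (λ x → + p ∣ x ^ p - x) (divides 0ℤ refl) up down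
    where
    p = suc q
    regroup : ∀ X Y x → X - (1ℤ + x) ≡ (Y - x) + (X - Y - 1ℤ)
    regroup = solve-∀
    shift : ∀ x → sucℤ x ^ p - sucℤ x ≡ (x ^ p - x) + ((1ℤ + x) ^ p - x ^ p - 1ℤ)
    shift x = regroup ((1ℤ + x) ^ p) (x ^ p) x
    up : ∀ x → + p ∣ x ^ p - x → + p ∣ sucℤ x ^ p - sucℤ x
    up x p∣x^p-x =
      subst (+ p ∣_) (sym (shift x)) (∣m∣n⇒∣m+n p∣x^p-x (p∣[1+x]^p-x^p-1 p-prime x))
    down : ∀ x → + p ∣ sucℤ x ^ p - sucℤ x → + p ∣ x ^ p - x
    down x p∣next = ∣m+n∣n⇒∣m (subst (+ p ∣_) (shift x) p∣next) (p∣[1+x]^p-x^p-1 p-prime x)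

  ∣x^[1+q]-x⇒∣x^[1+t*q]-x : ∀ {m} q → (∀ x → m ∣ x ^ suc q - x) →
                            ∀ t x → m ∣ x ^ suc (t ℕ.* q) - x
  ∣x^[1+q]-x⇒∣x^[1+t*q]-x {m} q m∣x^[1+q]-x zero x =
    subst (m ∣_) (sym (i≡j⇒i-j≡0 (^-identityʳ x))) (divides 0ℤ refl)
  ∣x^[1+q]-x⇒∣x^[1+t*q]-x {m} q m∣x^[1+q]-x (suc t) x = subst (m ∣_) (sym split)
    (∣m∣n⇒∣m+n (∣n⇒∣m*n (x ^ q) (∣x^[1+q]-x⇒∣x^[1+t*q]-x q m∣x^[1+q]-x t x))
                (m∣x^[1+q]-x x))
    where
    regroup : ∀ y Y X → Y * X - y ≡ Y * (X - y) + (y * Y - y)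
    regroup = solve-∀
    split : x ^ suc (q ℕ.+ t ℕ.* q) - x ≡ x ^ q * (x ^ suc (t ℕ.* q) - x) + (x ^ suc q - x)
    split = begin
      x ^ suc (q ℕ.+ t ℕ.* q) - x     ≡⟨ cong (λ e → x ^ e - x) (+-suc q (t ℕ.* q)) ⟨
      x ^ (q ℕ.+ suc (t ℕ.* q)) - x   ≡⟨ cong (_- x) (^-distribˡ-+-* x q (suc (t ℕ.* q))) ⟩
      x ^ q * x ^ suc (t ℕ.* q) - x   ≡⟨ regroup x (x ^ q) (x ^ suc (t ℕ.* q)) ⟩
      x ^ q * (x ^ suc (t ℕ.* q) - x) + (x ^ suc q - x) ∎

  p∣x^[1+k]-x : ∀ {p k} → Prime p → (p ∸ 1) ℕ.∣ k → ∀ x → + p ∣ x ^ suc k - x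
  p∣x^[1+k]-x {zero}  p-prime _                  = contradiction p-prime ¬prime[0]
  p∣x^[1+k]-x {suc q} p-prime (ℕ.divides t refl) =
    ∣x^[1+q]-x⇒∣x^[1+t*q]-x q (p∣x^p-x p-prime) t

  ∣x^k-x⇒∣[c+d]-[a+b] : ∀ {m k} a b c d → (∀ x → m ∣ x ^ k - x) →
                        a ^ k + b ^ k ≡ c ^ k + d ^ k → m ∣ (c + d) - (a + b)
  ∣x^k-x⇒∣[c+d]-[a+b] {m} {k} a b c d m∣x^k-x eq = subst (m ∣_) h≡
    (∣m∣n⇒∣m-n (∣m∣n⇒∣m+n (m∣x^k-x a) (m∣x^k-x b))
                (∣m∣n⇒∣m+n (m∣x^k-x c) (m∣x^k-x d)))
    where
    regroup : ∀ a b c d A B C D →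
              (A - a + (B - b)) - (C - c + (D - d)) ≡ (A + B) - (C + D) + ((c + d) - (a + b))
    regroup = solve-∀
    h≡ : (a ^ k - a + (b ^ k - b)) - (c ^ k - c + (d ^ k - d)) ≡ (c + d) - (a + b)
    h≡ = begin
      (a ^ k - a + (b ^ k - b)) - (c ^ k - c + (d ^ k - d))
        ≡⟨ regroup a b c d (a ^ k) (b ^ k) (c ^ k) (d ^ k) ⟩
      (a ^ k + b ^ k) - (c ^ k + d ^ k) + ((c + d) - (a + b))
        ≡⟨ cong (_+ ((c + d) - (a + b))) (i≡j⇒i-j≡0 eq) ⟩
      0ℤ + ((c + d) - (a + b))
        ≡⟨ +-identityˡ _ ⟩
      (c + d) - (a + b) ∎

open PowerCongruences

open import Data.Nat using (ℕ; zero; suc; _∸_; _≥_)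
open import Data.Nat.Divisibility using (_∣?_)
open import Data.Nat.Primality using (prime?)
open import Data.Integer using (ℤ; +_; _+_; _-_; _^_)
open import Data.Integer.Divisibility using (_∣_)
open import Data.Integer.Divisibility.Signed using (∣⇒∣ᵤ)
open import Data.List using (upTo)
open import Data.List.Relation.Unary.All as All using (All)
open import Data.List.Relation.Unary.All.Properties using (all-filter)
open import Data.List.Relation.Unary.Unique.Propositional using (Unique)
open import Data.List.Relation.Unary.Unique.Propositional.Properties using (filter⁺; upTo⁺)
open import Data.Product using (proj₁; _,_)
open import Relation.Nullary.Decidable using (_×-dec_)
open import Relation.Binary.PropositionalEquality using (_≡_)

𝒫-sound : ∀ k → All (InP k) (𝒫 k)
𝒫-sound k = all-filter (λ p → prime? p ×-dec ((p ∸ 1) ∣? (k ∸ 1))) (upTo (suc k))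

𝒫-unique : ∀ k → Unique (𝒫 k)
𝒫-unique k = filter⁺ (λ p → prime? p ×-dec ((p ∸ 1) ∣? (k ∸ 1))) (upTo⁺ (suc k))

theorem4p1 : (k : ℕ) → k ≥ 2 → (a b c d : ℤ) →
    a ^ k + b ^ k ≡ c ^ k + d ^ k →
    (+ M k) ∣ ((c + d) - (a + b))
theorem4p1 zero    ()
theorem4p1 k@(suc _) _ a b c d eq =
  distinctPrimes⇒product∣ (𝒫-unique k) (All.map proj₁ (𝒫-sound k))
                           (All.map p∣h (𝒫-sound k))
  where
  p∣h : ∀ {p} → InP k p → (+ p) ∣ (c + d) - (a + b)
  p∣h (p-prime , p-1∣k-1) =
    ∣⇒∣ᵤ (∣x^k-x⇒∣[c+d]-[a+b] {k = k} a b c d (p∣x^[1+k]-x p-prime p-1∣k-1) eq)
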